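{- Let $W$ be a right-angled Coxeter group and $u,v\in W$. Then the map \[ \phi:\mathrm{conv}(\mathrm{id},u,v)\to[\mathrm{id},u]_R\times[\mathrm{id},v]_R,\qquad x\mapsto(x\wedge_R u,\;x\wedge_R v) \] is well defined and injective.
   Context: A Coxeter group $W$ with simple generators $S$ and Coxeter matrix $(m_{ij})$ is right-angled if all $m_{ij}\in\{1,2,\infty\}$. The right weak order $\le_R$ on $W$ is generated by the covers $w\lessdot_R ws$ for $s\in S$ with $\ell(ws)=\ell(w)+1$ ($\ell$ the length with respect to $S$); it is a meet-semilattice with meet $\wedge_R$, and $[\mathrm{id},u]_R$ denotes the interval $\{x:\mathrm{id}\le_R x\le_R u\}$. $\mathrm{conv}(X)$ denotes the convex hull of $X$ in the Cayley graph of $(W,S)$ (vertices $W$, $x$ adjacent to $xs$, $s\in S$): a vertex set $C$ is convex if $a,b\in C$ and $d(a,c)+d(c,b)=d(a,b)$ imply $c\in C$, with $d$ the graph distance, and $\mathrm{conv}(X)$ is the intersection of all convex sets containing $X$. -}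

module Defs where

open import Data.Nat using (ℕ; zero; suc; _+_; _≤_)
open import Data.List using (List; []; _∷_; _++_; length; [_])
open import Data.Product using (Σ; _×_; _,_)
open import Data.Sum using (_⊎_)
open import Relation.Binary.PropositionalEquality using (_≡_)
open import Relation.Binary.Construct.Closure.Equivalence using (EqClosure)
open import Relation.Binary.Construct.Closure.ReflexiveTransitive using (Star)
open import Function.Bundles using (_⇔_)

-- Entries of a right-angled Coxeter matrix: m_ij ∈ {1, 2, ∞}.
data MEntry : Set where
  one two inf : MEntry

IsCoxeterMatrix : {S : Set} → (S → S → MEntry) → Set
IsCoxeterMatrix {S} m = (∀ i j → (m i j ≡ one) ⇔ (i ≡ j)) × (∀ i j → m i j ≡ m j i)

-- The right-angled Coxeter group W = ⟨ S | (st)^{m_st} = 1 (m_st < ∞) ⟩,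
-- elements represented by words over S, equality the congruence generated by the relators.
module Coxeter {S : Set} (m : S → S → MEntry) where

  Word : Set
  Word = List S

  data Relator : Word → Set where
    rel1 : ∀ s t → m s t ≡ one → Relator (s ∷ t ∷ [])
    rel2 : ∀ s t → m s t ≡ two → Relator (s ∷ t ∷ s ∷ t ∷ [])

  data Step : Word → Word → Set where
    ins : ∀ p r q → Relator r → Step (p ++ q) (p ++ r ++ q)

  _≈_ : Word → Word → Set
  _≈_ = EqClosure Step

  idW : Word
  idW = []

  -- a walk of length k from a to b in the Cayley graph (x adjacent to xs)
  Walk : Word → Word → ℕ → Set
  Walk a b k = Σ Word λ g → (length g ≡ k) × ((a ++ g) ≈ b)

  Dist : Word → Word → ℕ → Set
  Dist a b k = Walk a b k × (∀ j → Walk a b j → k ≤ j)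

  HasLength : Word → ℕ → Set
  HasLength w k = Dist idW w k

  Cover : Word → Word → Set
  Cover x y = Σ S λ s → (y ≈ (x ++ [ s ])) × Σ ℕ λ k → HasLength x k × HasLength y (suc k)

  _≤R_ : Word → Word → Set
  x ≤R y = Σ Word λ y' → Star Cover x y' × (y' ≈ y)

  IsMeet : Word → Word → Word → Set
  IsMeet x y z = (z ≤R x) × (z ≤R y) × (∀ w → w ≤R x → w ≤R y → w ≤R z)

  InInterval : Word → Word → Set
  InInterval u a = (idW ≤R a) × (a ≤R u)

  -- subsets of W: predicates on words invariant under ≈
  RespectsW : (Word → Set) → Set
  RespectsW C = ∀ x y → x ≈ y → C x → C y

  Convex : (Word → Set) → Set
  Convex C = ∀ a b c k₁ k₂ → C a → C b → Dist a c k₁ → Dist c b k₂ → Dist a b (k₁ + k₂) → C c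

  InConv : (Word → Set) → Word → Set₁
  InConv X x = ∀ (C : Word → Set) → RespectsW C → Convex C → (∀ y → X y → C y) → C x

  Three : Word → Word → Word → Set
  Three u v x = (x ≈ idW) ⊎ (x ≈ u) ⊎ (x ≈ v)

module Submission where

-- Pushing letters through commuting ones gives reduced words, hence the length ℓ, the
-- distance d a b = ℓ (a⁻¹ b) and the weak order x ≼ y ⇔ ℓ x + d x y = ℓ y. Every reflection
-- g s g⁻¹ cuts W into two convex halfspaces, so conv(id,u,v) lies in each halfspace containing
-- id, u and v. Meets exist (walk down from x along last letters pointing away from u) and lie
-- on a geodesic between their arguments. If x, y ∈ conv(id,u,v) have the same meets with u
-- and v but x ⋠ y, let p = x ∧ y and cross the wall of the first step from p towards x: id, y,
-- hence x ∧ u and x ∧ v, hence u and v stay on p's side while x does not. So x ≼ y, and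
-- symmetrically y ≼ x.

open import Defs
open import Data.Bool using (Bool; true; false; not)
open import Data.Bool.Properties using (T-≡; not-injective) renaming (_≟_ to _≟ᵇ_)
open import Data.Empty using (⊥; ⊥-elim)
open import Data.List using (List; []; _∷_; _++_; [_]; length; foldr; reverse)
open import Data.List.Properties
  using (++-assoc; ++-identityʳ; length-++; length-++-sucʳ; foldr-++;
         reverse-++; reverse-involutive; length-reverse; unfold-reverse)
open import Data.List.Relation.Unary.All using (All; []; _∷_)
open import Data.List.Relation.Unary.All.Properties using (∷ʳ⁺)
open import Data.List.Relation.Unary.Any using (here; there; any?; satisfied)
open import Data.List.Membership.Propositional using (_∈_; lose)
open import Data.Nat using (ℕ; suc; _+_; _≤_; _<_; z≤n; s≤s; _<ᵇ_; _≟_)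
open import Data.Nat.Properties
open import Data.Product using (Σ; _×_; _,_; proj₁; proj₂)
open import Data.Sum using (_⊎_; inj₁; inj₂)
open import Data.Unit using (⊤; tt)
open import Function.Bundles using (Equivalence)
open import Relation.Binary.Bundles using (Setoid)
open import Relation.Binary.Construct.Closure.Equivalence using (EqClosure; gmap; gfold)
import Relation.Binary.Construct.Closure.Equivalence as EqClosure
open import Relation.Binary.Construct.Closure.ReflexiveTransitive using (Star; ε; _◅_; _◅◅_)
import Relation.Binary.Construct.Closure.ReflexiveTransitive as Star
open import Relation.Binary.Construct.Closure.Symmetric using (fwd)
open import Relation.Binary.PropositionalEquality
  using (_≡_; refl; sym; trans; cong; cong₂; subst; subst₂; isEquivalence; module ≡-Reasoning)
import Relation.Binary.Reasoning.Setoid as SetoidReasoning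
open import Relation.Nullary using (¬_; Dec; yes; no)
open import Relation.Nullary.Decidable using (_×-dec_)

module RightAngled {S : Set} (m : S → S → MEntry) (cox : IsCoxeterMatrix m) where
  open Coxeter m

  ≈-setoid : Setoid _ _
  ≈-setoid = EqClosure.setoid Step

  open Setoid ≈-setoid
    using () renaming (refl to ≈-refl; sym to ≈-sym; trans to ≈-trans; reflexive to ≈-reflexive)

  module ≈-Reasoning = SetoidReasoning ≈-setoid

  insert : ∀ p q {r} → Relator r → (p ++ q) ≈ (p ++ r ++ q)
  insert p q {r} x = fwd (ins p r q x) ◅ ε

  step-congˡ : ∀ p {g h} → Step g h → Step (p ++ g) (p ++ h)
  step-congˡ p (ins a r b x) =
    subst₂ Step (++-assoc p a b) (++-assoc p a (r ++ b)) (ins (p ++ a) r b x)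

  step-congʳ : ∀ q {g h} → Step g h → Step (g ++ q) (h ++ q)
  step-congʳ q (ins a r b x) =
    subst₂ Step (sym (++-assoc a b q))
      (trans (cong (a ++_) (sym (++-assoc r b q))) (sym (++-assoc a (r ++ b) q)))
      (ins a r (b ++ q) x)

  ++-congˡ : ∀ p {g h} → g ≈ h → (p ++ g) ≈ (p ++ h)
  ++-congˡ p = gmap (p ++_) (step-congˡ p)

  ++-congʳ : ∀ q {g h} → g ≈ h → (g ++ q) ≈ (h ++ q)
  ++-congʳ q = gmap (_++ q) (step-congʳ q)

  ++-cong : ∀ {g g′ h h′} → g ≈ g′ → h ≈ h′ → (g ++ h) ≈ (g′ ++ h′)
  ++-cong {g′ = g′} {h} p q = ≈-trans (++-congʳ h p) (++-congˡ g′ q)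

  ∷-cong : ∀ s {g h} → g ≈ h → (s ∷ g) ≈ (s ∷ h)
  ∷-cong s = ++-congˡ [ s ]

  m-diagonal : ∀ s → m s s ≡ one
  m-diagonal s = Equivalence.from (proj₁ cox s s) refl

  cancel-pair : ∀ p s q → (p ++ s ∷ s ∷ q) ≈ (p ++ q)
  cancel-pair p s q = ≈-sym (insert p q (rel1 s s (m-diagonal s)))

  Commute : S → S → Set
  Commute s t = m s t ≡ two

  Commute-sym : ∀ {s t} → Commute s t → Commute t s
  Commute-sym {s} {t} c = trans (proj₂ cox t s) c

  Commute-irrefl : ∀ {s} → ¬ Commute s s
  Commute-irrefl {s} c with trans (sym (m-diagonal s)) c
  ... | ()

  swap-front : ∀ {s t} q → Commute s t → (s ∷ t ∷ q) ≈ (t ∷ s ∷ q)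
  swap-front {s} {t} q c = begin
    s ∷ t ∷ q                 ≈⟨ insert (s ∷ t ∷ []) q (rel2 t s (Commute-sym c)) ⟩
    s ∷ t ∷ t ∷ s ∷ t ∷ s ∷ q ≈⟨ cancel-pair [ s ] t (s ∷ t ∷ s ∷ q) ⟩
    s ∷ s ∷ t ∷ s ∷ q         ≈⟨ cancel-pair [] s (t ∷ s ∷ q) ⟩
    t ∷ s ∷ q                 ∎
    where open ≈-Reasoning

  -- Since every generator is an involution, the inverse of a word is its reversal.
  _⁻¹ : Word → Word
  _⁻¹ = reverse

  reverse-relator : ∀ {r} → Relator r → Relator (reverse r)
  reverse-relator (rel1 s t e) = rel1 t s (trans (proj₂ cox t s) e)
  reverse-relator (rel2 s t e) = rel2 t s (trans (proj₂ cox t s) e)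

  reverse-step : ∀ {g h} → Step g h → Step (reverse g) (reverse h)
  reverse-step (ins p r q x) =
    subst₂ Step (sym (reverse-++ p q)) (sym reverse-prq) (ins (reverse q) (reverse r) (reverse p) (reverse-relator x))
    where
    reverse-prq : reverse (p ++ r ++ q) ≡ reverse q ++ reverse r ++ reverse p
    reverse-prq = trans (reverse-++ p (r ++ q))
      (trans (cong (_++ reverse p) (reverse-++ r q)) (++-assoc (reverse q) (reverse r) (reverse p)))

  ⁻¹-cong : ∀ {g h} → g ≈ h → (g ⁻¹) ≈ (h ⁻¹)
  ⁻¹-cong = gmap reverse reverse-step

  inverseˡ : ∀ g → (g ⁻¹ ++ g) ≈ []
  inverseˡ [] = ≈-refl
  inverseˡ (s ∷ g) = begin
    (s ∷ g) ⁻¹ ++ s ∷ g       ≡⟨ cong (_++ s ∷ g) (unfold-reverse s g) ⟩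
    (g ⁻¹ ++ [ s ]) ++ s ∷ g  ≡⟨ ++-assoc (g ⁻¹) [ s ] (s ∷ g) ⟩
    g ⁻¹ ++ s ∷ s ∷ g         ≈⟨ cancel-pair (g ⁻¹) s g ⟩
    g ⁻¹ ++ g                 ≈⟨ inverseˡ g ⟩
    []                        ∎
    where open ≈-Reasoning

  inverseʳ : ∀ g → (g ++ g ⁻¹) ≈ []
  inverseʳ g = subst (λ h → (h ++ g ⁻¹) ≈ []) (reverse-involutive g) (inverseˡ (g ⁻¹))

  cancel-inverseˡ : ∀ a b → (a ⁻¹ ++ a ++ b) ≈ b
  cancel-inverseˡ a b = ≈-trans (≈-reflexive (sym (++-assoc (a ⁻¹) a b))) (++-congʳ b (inverseˡ a))

  cancel-inverseʳ : ∀ a b → (a ++ a ⁻¹ ++ b) ≈ b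
  cancel-inverseʳ a b = ≈-trans (≈-reflexive (sym (++-assoc a (a ⁻¹) b))) (++-congʳ b (inverseʳ a))

  cancel-quotients : ∀ a x u → ((a ⁻¹ ++ x) ⁻¹ ++ a ⁻¹ ++ u) ≈ (x ⁻¹ ++ u)
  cancel-quotients a x u = begin
    (a ⁻¹ ++ x) ⁻¹ ++ a ⁻¹ ++ u     ≡⟨ cong (_++ a ⁻¹ ++ u) (reverse-++ (a ⁻¹) x) ⟩
    (x ⁻¹ ++ a ⁻¹ ⁻¹) ++ a ⁻¹ ++ u  ≡⟨ cong (λ q → (x ⁻¹ ++ q) ++ a ⁻¹ ++ u) (reverse-involutive a) ⟩
    (x ⁻¹ ++ a) ++ a ⁻¹ ++ u        ≡⟨ ++-assoc (x ⁻¹) a (a ⁻¹ ++ u) ⟩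
    x ⁻¹ ++ a ++ a ⁻¹ ++ u          ≈⟨ ++-congˡ (x ⁻¹) (cancel-inverseʳ a u) ⟩
    x ⁻¹ ++ u                       ∎
    where open ≈-Reasoning

  -- Normal forms

  Free : S → S → Set
  Free s t = m s t ≡ inf

  data Comparison (s t : S) : Set where
    equal     : s ≡ t → Comparison s t
    commuting : Commute s t → Comparison s t
    free      : Free s t → Comparison s t

  compare : ∀ s t → Comparison s t
  compare s t with m s t in e
  ... | one = equal (Equivalence.to (proj₁ cox s t) e)
  ... | two = commuting e
  ... | inf = free e

  Free-irrefl : ∀ {s} → ¬ Free s s
  Free-irrefl {s} f with trans (sym (m-diagonal s)) f
  ... | ()

  Commute⇒¬Free : ∀ {s t} → Commute s t → ¬ Free s t
  Commute⇒¬Free c f with trans (sym c) f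
  ... | ()

  true≢false : ¬ true ≡ false
  true≢false ()

  -- For reduced w, push s w is a reduced word for s ∷ w: s travels right past the letters
  -- commuting with it until it cancels a copy of s or meets a letter it does not commute with.
  push : S → Word → Word
  push s [] = [ s ]
  push s (t ∷ w) with compare s t
  ... | equal _     = w
  ... | commuting _ = t ∷ push s w
  ... | free _      = s ∷ t ∷ w

  cancels : S → Word → Bool
  cancels s [] = false
  cancels s (t ∷ w) with compare s t
  ... | equal _     = true
  ... | commuting _ = cancels s w
  ... | free _      = false

  push-equal : ∀ s w → push s (s ∷ w) ≡ w
  push-equal s w with compare s s
  ... | equal _     = refl
  ... | commuting c = ⊥-elim (Commute-irrefl c)
  ... | free f      = ⊥-elim (Free-irrefl f)

  push-commuting : ∀ {s t} w → Commute s t → push s (t ∷ w) ≡ t ∷ push s w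
  push-commuting {s} {t} w c with compare s t
  ... | equal refl  = ⊥-elim (Commute-irrefl c)
  ... | commuting _ = refl
  ... | free f      = ⊥-elim (Commute⇒¬Free c f)

  push-free : ∀ {s t} w → Free s t → push s (t ∷ w) ≡ s ∷ t ∷ w
  push-free {s} {t} w f with compare s t
  ... | equal refl  = ⊥-elim (Free-irrefl f)
  ... | commuting c = ⊥-elim (Commute⇒¬Free c f)
  ... | free _      = refl

  cancels-equal : ∀ s w → cancels s (s ∷ w) ≡ true
  cancels-equal s w with compare s s
  ... | equal _     = refl
  ... | commuting c = ⊥-elim (Commute-irrefl c)
  ... | free f      = ⊥-elim (Free-irrefl f)

  cancels-commuting : ∀ {s t} w → Commute s t → cancels s (t ∷ w) ≡ cancels s w
  cancels-commuting {s} {t} w c with compare s t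
  ... | equal refl  = ⊥-elim (Commute-irrefl c)
  ... | commuting _ = refl
  ... | free f      = ⊥-elim (Commute⇒¬Free c f)

  cancels-free : ∀ {s t} w → Free s t → cancels s (t ∷ w) ≡ false
  cancels-free {s} {t} w f with compare s t
  ... | equal refl  = ⊥-elim (Free-irrefl f)
  ... | commuting c = ⊥-elim (Commute⇒¬Free c f)
  ... | free _      = refl

  Reduced : Word → Set
  Reduced []      = ⊤
  Reduced (s ∷ w) = (cancels s w ≡ false) × Reduced w

  data Swap : Word → Word → Set where
    here  : ∀ {a b} w → Commute a b → Swap (a ∷ b ∷ w) (b ∷ a ∷ w)
    there : ∀ x {w w′} → Swap w w′ → Swap (x ∷ w) (x ∷ w′)

  _~_ : Word → Word → Set
  _~_ = EqClosure Swap

  ~-sym : ∀ {g h} → g ~ h → h ~ g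
  ~-sym = EqClosure.symmetric Swap

  ~-cons : ∀ x {g h} → g ~ h → (x ∷ g) ~ (x ∷ h)
  ~-cons x = gmap (x ∷_) (there x)

  swap~ : ∀ {g h} → Swap g h → g ~ h
  swap~ x = fwd x ◅ ε

  Swap⇒≈ : ∀ {g h} → Swap g h → g ≈ h
  Swap⇒≈ (here w c)  = swap-front w c
  Swap⇒≈ (there x s) = ∷-cong x (Swap⇒≈ s)

  ~⇒length≡ : ∀ {g h} → g ~ h → length g ≡ length h
  ~⇒length≡ = gfold isEquivalence length length-resp
    where
    length-resp : ∀ {g h} → Swap g h → length g ≡ length h
    length-resp (here w c)  = refl
    length-resp (there x s) = cong suc (length-resp s)

  push-swap : ∀ s {w w′} → Swap w w′ → push s w ~ push s w′
  push-swap s (here {a} {b} w c) with compare s a | compare s b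
  ... | equal refl   | equal refl   = ⊥-elim (Commute-irrefl c)
  ... | equal refl   | commuting _  rewrite push-equal s w = ε
  ... | equal refl   | free f       = ⊥-elim (Commute⇒¬Free c f)
  ... | commuting _  | equal refl   rewrite push-equal s w = ε
  ... | free f       | equal refl   = ⊥-elim (Commute⇒¬Free (Commute-sym c) f)
  ... | commuting ca | commuting cb rewrite push-commuting w ca | push-commuting w cb = swap~ (here _ c)
  ... | commuting ca | free fb      rewrite push-free w fb =
    swap~ (here _ (Commute-sym ca)) ◅◅ swap~ (there s (here w c))
  ... | free fa      | commuting cb rewrite push-free w fa =
    swap~ (there s (here w c)) ◅◅ swap~ (here _ cb)
  ... | free _       | free _       = swap~ (there s (here w c))
  push-swap s (there x p) with compare s x
  ... | equal refl  = swap~ p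
  ... | commuting _ = ~-cons x (push-swap s p)
  ... | free _      = swap~ (there s (there x p))

  push-cong : ∀ s {w w′} → w ~ w′ → push s w ~ push s w′
  push-cong s = gfold (EqClosure.isEquivalence Swap) (push s) (push-swap s)

  cancels-push : ∀ {s t} w → Commute s t → cancels t (push s w) ≡ cancels t w
  cancels-push {s} {t} [] c with compare t s
  ... | equal refl  = ⊥-elim (Commute-irrefl c)
  ... | commuting _ = refl
  ... | free f      = ⊥-elim (Commute⇒¬Free (Commute-sym c) f)
  cancels-push {s} {t} (x ∷ w) c with compare s x
  ... | equal refl  = sym (cancels-commuting w (Commute-sym c))
  ... | free _      = cancels-commuting (x ∷ w) (Commute-sym c)
  ... | commuting _ with compare t x
  ...   | equal refl  = refl
  ...   | commuting _ = cancels-push w c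
  ...   | free _      = refl

  push-reduced : ∀ s w → Reduced w → Reduced (push s w)
  push-reduced s [] _ = refl , tt
  push-reduced s (x ∷ w) (cx , rw) with compare s x
  ... | equal refl  = rw
  ... | commuting c = trans (cancels-push w c) cx , push-reduced s w rw
  ... | free f      = cancels-free w f , cx , rw

  push-noncancelling : ∀ s w → cancels s w ≡ false → push s w ~ (s ∷ w)
  push-noncancelling s [] _ = ε
  push-noncancelling s (x ∷ w) e with compare s x
  ... | equal refl  = ⊥-elim (true≢false e)
  ... | commuting c = ~-cons x (push-noncancelling s w e) ◅◅ swap~ (here w (Commute-sym c))
  ... | free _      = ε

  push-push : ∀ s w → Reduced w → push s (push s w) ~ w
  push-push s [] _ rewrite push-equal s [] = ε
  push-push s (x ∷ w) (cx , rw) with compare s x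
  ... | equal refl  = push-noncancelling s w cx
  ... | commuting c rewrite push-commuting (push s w) c = ~-cons x (push-push s w rw)
  ... | free _      rewrite push-equal s (x ∷ w) = ε

  push-commute : ∀ {s t} w → Commute s t → push s (push t w) ~ push t (push s w)
  push-commute [] c rewrite push-commuting [] c | push-commuting [] (Commute-sym c) =
    swap~ (here [] (Commute-sym c))
  push-commute {s} {t} (x ∷ w) c with compare s x | compare t x
  ... | equal refl   | equal refl   = ⊥-elim (Commute-irrefl c)
  ... | equal refl   | commuting _  rewrite push-equal s (push t w) = ε
  ... | equal refl   | free ft      = ⊥-elim (Commute⇒¬Free (Commute-sym c) ft)
  ... | commuting _  | equal refl   rewrite push-equal t (push s w) = ε
  ... | free fs      | equal refl   = ⊥-elim (Commute⇒¬Free c fs)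
  ... | commuting cs | commuting ct
    rewrite push-commuting (push t w) cs | push-commuting (push s w) ct = ~-cons x (push-commute w c)
  ... | commuting cs | free ft
    rewrite push-commuting (x ∷ w) c | push-commuting w cs | push-free (push s w) ft = ε
  ... | free fs      | commuting ct
    rewrite push-commuting (x ∷ w) (Commute-sym c) | push-commuting w ct | push-free (push t w) fs = ε
  ... | free fs      | free ft
    rewrite push-commuting (x ∷ w) c | push-free w fs | push-commuting (x ∷ w) (Commute-sym c) | push-free w ft =
    swap~ (here (x ∷ w) (Commute-sym c))

  nf : Word → Word
  nf = foldr push []

  nf-reduced : ∀ g → Reduced (nf g)
  nf-reduced []      = tt
  nf-reduced (s ∷ g) = push-reduced s (nf g) (nf-reduced g)

  push≈∷ : ∀ s w → push s w ≈ (s ∷ w)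
  push≈∷ s [] = ≈-refl
  push≈∷ s (x ∷ w) with compare s x
  ... | equal refl  = ≈-sym (cancel-pair [] s w)
  ... | commuting c = ≈-trans (∷-cong x (push≈∷ s w)) (swap-front w (Commute-sym c))
  ... | free _      = ≈-refl

  nf≈ : ∀ g → nf g ≈ g
  nf≈ []      = ≈-refl
  nf≈ (s ∷ g) = ≈-trans (push≈∷ s (nf g)) (∷-cong s (nf≈ g))

  pushAll-cong : ∀ p {w w′} → w ~ w′ → foldr push w p ~ foldr push w′ p
  pushAll-cong []      e = e
  pushAll-cong (s ∷ p) e = push-cong s (pushAll-cong p e)

  pushAll-relator : ∀ {r} w → Reduced w → Relator r → foldr push w r ~ w
  pushAll-relator w rw (rel1 s t e) with Equivalence.to (proj₁ cox s t) e
  ... | refl = push-push s w rw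
  pushAll-relator w rw (rel2 s t c) =
    push-cong s (push-commute (push t w) (Commute-sym c))
    ◅◅ push-push s (push t (push t w)) (push-reduced t _ (push-reduced t w rw))
    ◅◅ push-push t w rw

  nf-step : ∀ {g h} → Step g h → nf g ~ nf h
  nf-step (ins p r q x) rewrite foldr-++ push [] p q | foldr-++ push [] p (r ++ q) | foldr-++ push [] r q =
    pushAll-cong p (~-sym (pushAll-relator (nf q) (nf-reduced q) x))

  nf-cong : ∀ {g h} → g ≈ h → nf g ~ nf h
  nf-cong = gfold (EqClosure.isEquivalence Swap) nf nf-step

  ℓ : Word → ℕ
  ℓ g = length (nf g)

  ℓ-cong : ∀ {g h} → g ≈ h → ℓ g ≡ ℓ h
  ℓ-cong e = ~⇒length≡ (nf-cong e)

  push-length-cancelling : ∀ s w → cancels s w ≡ true → suc (length (push s w)) ≡ length w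
  push-length-cancelling s (x ∷ w) e with compare s x
  ... | equal refl  = refl
  ... | commuting _ = cong suc (push-length-cancelling s w e)

  push-length-noncancelling : ∀ s w → cancels s w ≡ false → length (push s w) ≡ suc (length w)
  push-length-noncancelling s w e = ~⇒length≡ (push-noncancelling s w e)

  push-length≤ : ∀ s w → length (push s w) ≤ suc (length w)
  push-length≤ s w with cancels s w in e
  ... | true  = m≤n⇒m≤1+n (<⇒≤ (≤-reflexive (push-length-cancelling s w e)))
  ... | false = ≤-reflexive (push-length-noncancelling s w e)

  ℓ≤length : ∀ g → ℓ g ≤ length g
  ℓ≤length []      = z≤n
  ℓ≤length (s ∷ g) = ≤-trans (push-length≤ s (nf g)) (s≤s (ℓ≤length g))

  ℓ-minimal : ∀ {g h} → g ≈ h → ℓ g ≤ length h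
  ℓ-minimal {g} {h} e = ≤-trans (≤-reflexive (ℓ-cong e)) (ℓ≤length h)

  reduced⇒ℓ≡length : ∀ w → Reduced w → ℓ w ≡ length w
  reduced⇒ℓ≡length w r = ~⇒length≡ (nf~ w r)
    where
    nf~ : ∀ w → Reduced w → nf w ~ w
    nf~ []      _       = ε
    nf~ (s ∷ w) (c , r) = push-cong s (nf~ w r) ◅◅ push-noncancelling s w c

  ℓ-∷ : ∀ s g → (ℓ (s ∷ g) ≡ suc (ℓ g)) ⊎ (suc (ℓ (s ∷ g)) ≡ ℓ g)
  ℓ-∷ s g with cancels s (nf g) in e
  ... | true  = inj₂ (push-length-cancelling s (nf g) e)
  ... | false = inj₁ (push-length-noncancelling s (nf g) e)

  ℓ-∷≤ : ∀ s g → ℓ (s ∷ g) ≤ suc (ℓ g)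
  ℓ-∷≤ s g = push-length≤ s (nf g)

  ℓ-⁻¹ : ∀ g → ℓ (g ⁻¹) ≡ ℓ g
  ℓ-⁻¹ g = ≤-antisym (ℓ-⁻¹≤ g)
    (subst (λ h → ℓ h ≤ ℓ (g ⁻¹)) (reverse-involutive g) (ℓ-⁻¹≤ (g ⁻¹)))
    where
    ℓ-⁻¹≤ : ∀ g → ℓ (g ⁻¹) ≤ ℓ g
    ℓ-⁻¹≤ g = ≤-trans (ℓ-minimal (⁻¹-cong (≈-sym (nf≈ g)))) (≤-reflexive (length-reverse (nf g)))

  ℓ-∷ʳ : ∀ g s → ℓ (g ++ [ s ]) ≡ ℓ (s ∷ g ⁻¹)
  ℓ-∷ʳ g s = trans (sym (ℓ-⁻¹ (g ++ [ s ]))) (cong ℓ (reverse-++ g [ s ]))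

  ℓ-∷ʳ≤ : ∀ g s → ℓ (g ++ [ s ]) ≤ suc (ℓ g)
  ℓ-∷ʳ≤ g s = ≤-trans (≤-reflexive (ℓ-∷ʳ g s))
    (≤-trans (ℓ-∷≤ s (g ⁻¹)) (s≤s (≤-reflexive (ℓ-⁻¹ g))))

  ℓ-∷ʳ± : ∀ g s → (ℓ (g ++ [ s ]) ≡ suc (ℓ g)) ⊎ (suc (ℓ (g ++ [ s ])) ≡ ℓ g)
  ℓ-∷ʳ± g s rewrite ℓ-∷ʳ g s | sym (ℓ-⁻¹ g) = ℓ-∷ s (g ⁻¹)

  ℓ-++ : ∀ g h → ℓ (g ++ h) ≤ ℓ g + ℓ h
  ℓ-++ g h = ≤-trans (ℓ-minimal (≈-sym (++-cong (nf≈ g) (nf≈ h)))) (≤-reflexive (length-++ (nf g)))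

  ℓ≡length⇒reduced : ∀ w → ℓ w ≡ length w → Reduced w
  ℓ≡length⇒reduced []      _ = tt
  ℓ≡length⇒reduced (s ∷ w) e = noncancelling , ℓ≡length⇒reduced w ℓw≡
    where
    ℓw≡ : ℓ w ≡ length w
    ℓw≡ = ≤-antisym (ℓ≤length w) (≤-pred (≤-trans (≤-reflexive (sym e)) (ℓ-∷≤ s w)))
    noncancelling : cancels s w ≡ false
    noncancelling with cancels s w in c
    ... | false = refl
    ... | true  = ⊥-elim (1+n≰n (≤-trans (n≤1+n _) (subst (λ k → suc k ≤ length w) e ℓ<)))
      where
      ℓ< : suc (ℓ (s ∷ w)) ≤ length w
      ℓ< = ≤-trans (s≤s (ℓ-minimal (≈-sym (push≈∷ s w)))) (≤-reflexive (push-length-cancelling s w c))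

  reduced-cancelling⇒ℓ< : ∀ s w → Reduced w → cancels s w ≡ true → ℓ (s ∷ w) < ℓ w
  reduced-cancelling⇒ℓ< s w r e =
    ≤-trans (s≤s (ℓ-minimal (≈-sym (push≈∷ s w))))
            (≤-reflexive (trans (push-length-cancelling s w e) (sym (reduced⇒ℓ≡length w r))))

  reduced-noncancelling⇒ℓ≡ : ∀ s w → Reduced w → cancels s w ≡ false → ℓ (s ∷ w) ≡ suc (ℓ w)
  reduced-noncancelling⇒ℓ≡ s w r e =
    trans (reduced⇒ℓ≡length (s ∷ w) (e , r)) (cong suc (sym (reduced⇒ℓ≡length w r)))

  reverse-reduced : ∀ w → Reduced w → Reduced (w ⁻¹)
  reverse-reduced w r =
    ℓ≡length⇒reduced (w ⁻¹) (trans (ℓ-⁻¹ w) (trans (reduced⇒ℓ≡length w r) (sym (length-reverse w))))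

  d : Word → Word → ℕ
  d a b = ℓ (a ⁻¹ ++ b)

  geodesic-walk : ∀ a b → Walk a b (d a b)
  geodesic-walk a b =
    nf (a ⁻¹ ++ b) , refl , ≈-trans (++-congˡ a (nf≈ (a ⁻¹ ++ b))) (cancel-inverseʳ a b)

  d-minimal : ∀ {a b k} → Walk a b k → d a b ≤ k
  d-minimal {a} (g , refl , e) = ℓ-minimal (≈-trans (++-congˡ (a ⁻¹) (≈-sym e)) (cancel-inverseˡ a g))

  Dist-d : ∀ a b → Dist a b (d a b)
  Dist-d a b = geodesic-walk a b , λ _ → d-minimal

  Dist⇒≡d : ∀ {a b k} → Dist a b k → k ≡ d a b
  Dist⇒≡d {a} {b} (walk , minimal) = ≤-antisym (minimal _ (geodesic-walk a b)) (d-minimal walk)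

  d-congˡ : ∀ {a a′} b → a ≈ a′ → d a b ≡ d a′ b
  d-congˡ b e = ℓ-cong (++-congʳ b (⁻¹-cong e))

  d-congʳ : ∀ a {b b′} → b ≈ b′ → d a b ≡ d a b′
  d-congʳ a e = ℓ-cong (++-congˡ (a ⁻¹) e)

  d-triangle : ∀ a b c → d a c ≤ d a b + d b c
  d-triangle a b c = ≤-trans (≤-reflexive (ℓ-cong (≈-sym through-b))) (ℓ-++ (a ⁻¹ ++ b) (b ⁻¹ ++ c))
    where
    through-b : ((a ⁻¹ ++ b) ++ b ⁻¹ ++ c) ≈ (a ⁻¹ ++ c)
    through-b = ≈-trans (≈-reflexive (++-assoc (a ⁻¹) b _)) (++-congˡ (a ⁻¹) (cancel-inverseʳ b c))

  d-sym : ∀ a b → d a b ≡ d b a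
  d-sym a b = begin
    ℓ (a ⁻¹ ++ b)               ≡⟨ ℓ-⁻¹ (a ⁻¹ ++ b) ⟨
    ℓ ((a ⁻¹ ++ b) ⁻¹)          ≡⟨ cong ℓ (reverse-++ (a ⁻¹) b) ⟩
    ℓ (b ⁻¹ ++ (a ⁻¹) ⁻¹)       ≡⟨ cong (λ g → ℓ (b ⁻¹ ++ g)) (reverse-involutive a) ⟩
    ℓ (b ⁻¹ ++ a)               ∎
    where open ≡-Reasoning

  d-self : ∀ a → d a a ≡ 0
  d-self a = ℓ-cong (inverseˡ a)

  d≡0⇒≈ : ∀ {a b} → d a b ≡ 0 → a ≈ b
  d≡0⇒≈ {a} {b} e with nf (a ⁻¹ ++ b) in n≡
  ... | [] = begin
    a               ≡⟨ ++-identityʳ a ⟨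
    a ++ []         ≈⟨ ++-congˡ a (≈-trans (≈-reflexive (sym n≡)) (nf≈ (a ⁻¹ ++ b))) ⟩
    a ++ a ⁻¹ ++ b  ≈⟨ cancel-inverseʳ a b ⟩
    b               ∎
    where open ≈-Reasoning

  d-∷ʳ : ∀ a s → d a (a ++ [ s ]) ≡ 1
  d-∷ʳ a s = ℓ-cong (cancel-inverseˡ a [ s ])

  -- The right weak order

  record _≼_ (x y : Word) : Set where
    constructor geodesic
    field on-geodesic : ℓ x + d x y ≡ ℓ y
  open _≼_

  ≼-refl : ∀ x → x ≼ x
  ≼-refl x = geodesic (trans (cong (ℓ x +_) (d-self x)) (+-identityʳ (ℓ x)))

  ≼-trans : ∀ {x y z} → x ≼ y → y ≼ z → x ≼ z
  ≼-trans {x} {y} {z} (geodesic p) (geodesic q) = geodesic (≤-antisym ≤ℓz (d-triangle [] x z))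
    where
    ≤ℓz : ℓ x + d x z ≤ ℓ z
    ≤ℓz = begin
      ℓ x + d x z            ≤⟨ +-monoʳ-≤ (ℓ x) (d-triangle x y z) ⟩
      ℓ x + (d x y + d y z)  ≡⟨ +-assoc (ℓ x) (d x y) (d y z) ⟨
      ℓ x + d x y + d y z    ≡⟨ cong (_+ d y z) p ⟩
      ℓ y + d y z            ≡⟨ q ⟩
      ℓ z                    ∎
      where open ≤-Reasoning

  ≼-resp : ∀ {x x′ y y′} → x ≈ x′ → y ≈ y′ → x ≼ y → x′ ≼ y′
  ≼-resp {x} {x′} {y} {y′} ex ey (geodesic p) = geodesic (begin
    ℓ x′ + d x′ y′ ≡⟨ cong₂ _+_ (ℓ-cong (≈-sym ex))
                        (trans (d-congˡ y′ (≈-sym ex)) (d-congʳ x (≈-sym ey))) ⟩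
    ℓ x + d x y    ≡⟨ p ⟩
    ℓ y            ≡⟨ ℓ-cong ey ⟩
    ℓ y′           ∎)
    where open ≡-Reasoning

  ≼-antisym : ∀ {x y} → x ≼ y → y ≼ x → x ≈ y
  ≼-antisym {x} {y} (geodesic p) (geodesic q) =
    d≡0⇒≈ (m+n≡0⇒m≡0 (d x y) (+-cancelˡ-≡ (ℓ x) (d x y + d x y) 0 round-trip))
    where
    round-trip : ℓ x + (d x y + d x y) ≡ ℓ x + 0
    round-trip = begin
      ℓ x + (d x y + d x y) ≡⟨ +-assoc (ℓ x) (d x y) (d x y) ⟨
      ℓ x + d x y + d x y   ≡⟨ cong₂ _+_ p (d-sym x y) ⟩
      ℓ y + d y x           ≡⟨ q ⟩
      ℓ x                   ≡⟨ +-identityʳ (ℓ x) ⟨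
      ℓ x + 0               ∎
      where open ≡-Reasoning

  ≼⇒ℓ≤ : ∀ {x y} → x ≼ y → ℓ x ≤ ℓ y
  ≼⇒ℓ≤ {x} {y} (geodesic e) = ≤-trans (m≤m+n (ℓ x) (d x y)) (≤-reflexive e)

  ≼-chain : ∀ {p q x} → p ≼ q → q ≼ x → d p q + d q x ≡ d p x
  ≼-chain {p} {q} {x} p≼q@(geodesic e₁) q≼x@(geodesic e₂) = +-cancelˡ-≡ (ℓ p) _ _ (begin
    ℓ p + (d p q + d q x)  ≡⟨ +-assoc (ℓ p) (d p q) (d q x) ⟨
    ℓ p + d p q + d q x    ≡⟨ cong (_+ d q x) e₁ ⟩
    ℓ q + d q x            ≡⟨ e₂ ⟩
    ℓ x                    ≡⟨ on-geodesic (≼-trans p≼q q≼x) ⟨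
    ℓ p + d p x            ∎)
    where open ≡-Reasoning

  ≼-step-up : ∀ {p q y} → p ≼ y → ℓ q ≤ suc (ℓ p) → d q y < d p y → q ≼ y
  ≼-step-up {p} {q} {y} (geodesic e) lq closer = geodesic (≤-antisym (begin
    ℓ q + d q y        ≤⟨ +-monoˡ-≤ (d q y) lq ⟩
    suc (ℓ p) + d q y  ≡⟨ +-suc (ℓ p) (d q y) ⟨
    ℓ p + suc (d q y)  ≤⟨ +-monoʳ-≤ (ℓ p) closer ⟩
    ℓ p + d p y        ≡⟨ e ⟩
    ℓ y                ∎) (d-triangle [] q y))
    where open ≤-Reasoning

  ≼-step-down : ∀ {w p q} → w ≼ p → ℓ p ≤ suc (ℓ q) → d w q < d w p → w ≼ q
  ≼-step-down {w} {p} {q} (geodesic e) lp closer = geodesic (≤-antisym (≤-pred (begin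
    suc (ℓ w + d w q)  ≡⟨ +-suc (ℓ w) (d w q) ⟨
    ℓ w + suc (d w q)  ≤⟨ +-monoʳ-≤ (ℓ w) closer ⟩
    ℓ w + d w p        ≡⟨ e ⟩
    ℓ p                ≤⟨ lp ⟩
    suc (ℓ q)          ∎)) (d-triangle [] w q))
    where open ≤-Reasoning

  ≼-closer⇒ℓ< : ∀ {p q y} → p ≼ y → q ≼ y → d q y < d p y → ℓ p < ℓ q
  ≼-closer⇒ℓ< {p} {q} {y} (geodesic e₁) (geodesic e₂) closer = +-cancelʳ-≤ (d q y) _ _ (begin
    suc (ℓ p) + d q y  ≡⟨ +-suc (ℓ p) (d q y) ⟨
    ℓ p + suc (d q y)  ≤⟨ +-monoʳ-≤ (ℓ p) closer ⟩
    ℓ p + d p y        ≡⟨ trans e₁ (sym e₂) ⟩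
    ℓ q + d q y        ∎)
    where open ≤-Reasoning

  ≼-∷ʳ : ∀ p t → ℓ (p ++ [ t ]) ≡ suc (ℓ p) → p ≼ (p ++ [ t ])
  ≼-∷ʳ p t e = geodesic (trans (cong (ℓ p +_) (d-∷ʳ p t)) (trans (+-comm (ℓ p) 1) (sym e)))

  first-step-up : ∀ x t γ → ℓ x + length (t ∷ γ) ≡ ℓ (x ++ t ∷ γ) → ℓ (x ++ [ t ]) ≡ suc (ℓ x)
  first-step-up x t γ e = ≤-antisym (ℓ-∷ʳ≤ x t) (+-cancelʳ-≤ (length γ) _ _ (begin
    suc (ℓ x) + length γ        ≡⟨ +-suc (ℓ x) (length γ) ⟨
    ℓ x + length (t ∷ γ)        ≡⟨ e ⟩
    ℓ (x ++ t ∷ γ)              ≡⟨ cong ℓ (++-assoc x [ t ] γ) ⟨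
    ℓ ((x ++ [ t ]) ++ γ)       ≤⟨ ℓ-++ (x ++ [ t ]) γ ⟩
    ℓ (x ++ [ t ]) + ℓ γ        ≤⟨ +-monoʳ-≤ (ℓ (x ++ [ t ])) (ℓ≤length γ) ⟩
    ℓ (x ++ [ t ]) + length γ   ∎))
    where open ≤-Reasoning

  ≼-first-step : ∀ {p x} → p ≼ x → ¬ d p x ≡ 0 → Σ S λ t → p ≼ (p ++ [ t ]) × (p ++ [ t ]) ≼ x
  ≼-first-step {p} {x} p≼x ne with geodesic-walk p x
  ... | []      , lγ , _       = ⊥-elim (ne (sym lγ))
  ... | t ∷ γ   , lγ , reaches = t , ≼-∷ʳ p t up , ≼-step-up p≼x (≤-reflexive up) closer
    where
    up : ℓ (p ++ [ t ]) ≡ suc (ℓ p)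
    up = first-step-up p t γ (trans (cong (ℓ p +_) lγ) (trans (on-geodesic p≼x) (ℓ-cong (≈-sym reaches))))
    closer : d (p ++ [ t ]) x < d p x
    closer = ≤-trans (s≤s (d-minimal (γ , refl , ≈-trans (≈-reflexive (++-assoc p [ t ] γ)) reaches)))
                     (≤-reflexive lγ)

  Cover⇒≼ : ∀ {x y} → Cover x y → x ≼ y
  Cover⇒≼ {x} {y} (s , e , k , hx , hy) = geodesic (begin
    ℓ x + d x y  ≡⟨ cong (ℓ x +_) (trans (d-congʳ x e) (d-∷ʳ x s)) ⟩
    ℓ x + 1      ≡⟨ +-comm (ℓ x) 1 ⟩
    suc (ℓ x)    ≡⟨ cong suc (Dist⇒≡d hx) ⟨
    suc k        ≡⟨ Dist⇒≡d hy ⟩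
    ℓ y          ∎)
    where open ≡-Reasoning

  ≤R⇒≼ : ∀ {x y} → x ≤R y → x ≼ y
  ≤R⇒≼ (_ , covers , e) =
    ≼-resp ≈-refl e (Star.fold _≼_ (λ c r → ≼-trans (Cover⇒≼ c) r) (λ {x} → ≼-refl x) covers)

  geodesic-tail : ∀ x t γ → ℓ x + length (t ∷ γ) ≡ ℓ (x ++ t ∷ γ) →
                  ℓ (x ++ [ t ]) + length γ ≡ ℓ ((x ++ [ t ]) ++ γ)
  geodesic-tail x t γ e = begin
    ℓ (x ++ [ t ]) + length γ  ≡⟨ cong (_+ length γ) (first-step-up x t γ e) ⟩
    suc (ℓ x) + length γ       ≡⟨ +-suc (ℓ x) (length γ) ⟨
    ℓ x + length (t ∷ γ)       ≡⟨ e ⟩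
    ℓ (x ++ t ∷ γ)             ≡⟨ cong ℓ (++-assoc x [ t ] γ) ⟨
    ℓ ((x ++ [ t ]) ++ γ)      ∎
    where open ≡-Reasoning

  covers-along : ∀ x γ → ℓ x + length γ ≡ ℓ (x ++ γ) → Σ Word λ y → Star Cover x y × (y ≈ (x ++ γ))
  covers-along x [] _ = x , ε , ≈-reflexive (sym (++-identityʳ x))
  covers-along x (t ∷ γ) e with covers-along (x ++ [ t ]) γ (geodesic-tail x t γ e)
  ... | y , covers , ey = y , cover ◅ covers , ≈-trans ey (≈-reflexive (++-assoc x [ t ] γ))
    where
    cover : Cover x (x ++ [ t ])
    cover = t , ≈-refl , ℓ x , Dist-d [] x ,
            subst (Dist [] (x ++ [ t ])) (first-step-up x t γ e) (Dist-d [] (x ++ [ t ]))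

  ≼⇒≤R : ∀ {x y} → x ≼ y → x ≤R y
  ≼⇒≤R {x} {y} (geodesic p) with geodesic-walk x y
  ... | γ , lγ , reaches with covers-along x γ (trans (cong (ℓ x +_) lγ) (trans p (ℓ-cong (≈-sym reaches))))
  ...   | y′ , covers , e = y′ , covers , ≈-trans e reaches

  cancels-++ʳ : ∀ s P Q → cancels s P ≡ true → cancels s (P ++ Q) ≡ true
  cancels-++ʳ s [] Q ()
  cancels-++ʳ s (x ∷ P) Q e with compare s x
  cancels-++ʳ s (x ∷ P) Q e  | equal _     = refl
  cancels-++ʳ s (x ∷ P) Q e  | commuting _ = cancels-++ʳ s P Q e
  cancels-++ʳ s (x ∷ P) Q () | free _

  cancels-++ : ∀ s P Q → cancels s (P ++ Q) ≡ true →
               (cancels s P ≡ true) ⊎ (All (Commute s) P × cancels s Q ≡ true)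
  cancels-++ s [] Q e = inj₂ ([] , e)
  cancels-++ s (x ∷ P) Q e with compare s x
  cancels-++ s (x ∷ P) Q e  | equal _     = inj₁ refl
  cancels-++ s (x ∷ P) Q e  | commuting c with cancels-++ s P Q e
  ... | inj₁ e′         = inj₁ e′
  ... | inj₂ (cs , e′)  = inj₂ (c ∷ cs , e′)
  cancels-++ s (x ∷ P) Q () | free _

  cancels-through : ∀ {s} A B → All (Commute s) A → cancels s (A ++ s ∷ B) ≡ true
  cancels-through {s} []      B []       = cancels-equal s B
  cancels-through     (x ∷ A) B (c ∷ cs) = trans (cancels-commuting (A ++ _ ∷ B) c) (cancels-through A B cs)

  All-reverse : ∀ {P : S → Set} {A} → All P A → All P (reverse A)
  All-reverse []                   = []
  All-reverse {A = x ∷ A} (px ∷ pA) = subst (All _) (sym (unfold-reverse x A)) (∷ʳ⁺ (All-reverse pA) px)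

  -- cancels s (P ⁻¹) says that s can be moved to the end of P.
  reduced-++ : ∀ P Q → Reduced P → Reduced Q →
               (∀ s → cancels s (P ⁻¹) ≡ true → cancels s Q ≡ true → ⊥) → Reduced (P ++ Q)
  reduced-++ []      Q _         rQ _           = rQ
  reduced-++ (x ∷ P) Q (cx , rP) rQ no-junction =
    noncancelling , reduced-++ P Q rP rQ (λ s e → no-junction s (to-end s e))
    where
    to-end : ∀ s → cancels s (P ⁻¹) ≡ true → cancels s ((x ∷ P) ⁻¹) ≡ true
    to-end s e rewrite unfold-reverse x P = cancels-++ʳ s (P ⁻¹) [ x ] e
    noncancelling : cancels x (P ++ Q) ≡ false
    noncancelling with cancels x (P ++ Q) in e
    ... | false = refl
    ... | true with cancels-++ x P Q e
    ...   | inj₁ e′         = ⊥-elim (true≢false (trans (sym e′) cx))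
    ...   | inj₂ (cs , eQ)  = ⊥-elim (no-junction x x-to-end eQ)
      where
      x-to-end : cancels x ((x ∷ P) ⁻¹) ≡ true
      x-to-end rewrite unfold-reverse x P = cancels-through (P ⁻¹) [] (All-reverse cs)

  cancels⇒∈ : ∀ s w → cancels s w ≡ true → s ∈ w
  cancels⇒∈ s []      ()
  cancels⇒∈ s (x ∷ w) e  with compare s x
  cancels⇒∈ s (x ∷ w) e  | equal s≡x   = here s≡x
  cancels⇒∈ s (x ∷ w) e  | commuting _ = there (cancels⇒∈ s w e)
  cancels⇒∈ s (x ∷ w) () | free _

  last-letter-shortens : ∀ X s → Reduced X → cancels s (X ⁻¹) ≡ true → suc (ℓ (X ++ [ s ])) ≡ ℓ X
  last-letter-shortens X s r c with ℓ-∷ʳ± X s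
  ... | inj₂ down = down
  ... | inj₁ up   = ⊥-elim (<⇒≱ shorter (≤-trans (n≤1+n (ℓ X)) (≤-reflexive (sym up))))
    where
    shorter : ℓ (X ++ [ s ]) < ℓ X
    shorter = begin-strict
      ℓ (X ++ [ s ])  ≡⟨ ℓ-∷ʳ X s ⟩
      ℓ (s ∷ X ⁻¹)    <⟨ reduced-cancelling⇒ℓ< s (X ⁻¹) (reverse-reduced X r) c ⟩
      ℓ (X ⁻¹)        ≡⟨ ℓ-⁻¹ X ⟩
      ℓ X             ∎
      where open ≤-Reasoning

  descent : S → Word → Bool
  descent s w = ℓ (s ∷ w) <ᵇ ℓ w

  descent-cong : ∀ s {w w′} → w ≈ w′ → descent s w ≡ descent s w′
  descent-cong s e = cong₂ _<ᵇ_ (ℓ-cong (∷-cong s e)) (ℓ-cong e)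

  descent⇒ℓ< : ∀ s w → descent s w ≡ true → ℓ (s ∷ w) < ℓ w
  descent⇒ℓ< s w e = <ᵇ⇒< _ _ (Equivalence.from T-≡ e)

  ℓ<⇒descent : ∀ s w → ℓ (s ∷ w) < ℓ w → descent s w ≡ true
  ℓ<⇒descent s w lt = Equivalence.to T-≡ (<⇒<ᵇ lt)

  ℓ>⇒non-descent : ∀ s w → ℓ (s ∷ w) ≡ suc (ℓ w) → descent s w ≡ false
  ℓ>⇒non-descent s w e with descent s w in eq
  ... | false = refl
  ... | true  = ⊥-elim (<⇒≱ (descent⇒ℓ< s w eq) (≤-trans (n≤1+n (ℓ w)) (≤-reflexive (sym e))))

  reduced⇒descent≡cancels : ∀ s w → Reduced w → descent s w ≡ cancels s w
  reduced⇒descent≡cancels s w r with cancels s w in e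
  ... | true  = ℓ<⇒descent s w (reduced-cancelling⇒ℓ< s w r e)
  ... | false = ℓ>⇒non-descent s w (reduced-noncancelling⇒ℓ≡ s w r e)

  ℓ-∷-∷ : ∀ s w → ℓ (s ∷ s ∷ w) ≡ ℓ w
  ℓ-∷-∷ s w = ℓ-cong (cancel-pair [] s w)

  descent-∷ : ∀ s w → descent s (s ∷ w) ≡ not (descent s w)
  descent-∷ s w with ℓ-∷ s w
  ... | inj₁ up   = trans (ℓ<⇒descent s (s ∷ w) (subst₂ _<_ (sym (ℓ-∷-∷ s w)) (sym up) ≤-refl))
                          (cong not (sym (ℓ>⇒non-descent s w up)))
  ... | inj₂ down = trans (ℓ>⇒non-descent s (s ∷ w) (trans (ℓ-∷-∷ s w) (sym down)))
                          (cong not (sym (ℓ<⇒descent s w (≤-reflexive down))))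

  move-to-front : ∀ {s} A B → All (Commute s) A → (A ++ s ∷ B) ≈ (s ∷ A ++ B)
  move-to-front []      B []       = ≈-refl
  move-to-front (x ∷ A) B (c ∷ cs) = ≈-trans (∷-cong x (move-to-front A B cs)) (swap-front (A ++ B) (Commute-sym c))

  cancels-singleton : ∀ s t → cancels s [ t ] ≡ true → s ≡ t
  cancels-singleton s t e  with compare s t
  cancels-singleton s t e  | equal s≡t  = s≡t
  cancels-singleton s t () | commuting _
  cancels-singleton s t () | free _

  cancel-∷ʳ-∷ʳ : ∀ w t → ((w ++ [ t ]) ++ [ t ]) ≈ w
  cancel-∷ʳ-∷ʳ w t = begin
    (w ++ [ t ]) ++ [ t ]  ≡⟨ ++-assoc w [ t ] [ t ] ⟩
    w ++ t ∷ t ∷ []        ≈⟨ cancel-pair w t [] ⟩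
    w ++ []                ≡⟨ ++-identityʳ w ⟩
    w                      ∎
    where open ≈-Reasoning

  nf-∷ʳ-reduced : ∀ w t → ℓ (w ++ [ t ]) ≡ suc (ℓ w) → Reduced (nf w ++ [ t ])
  nf-∷ʳ-reduced w t up = ℓ≡length⇒reduced (nf w ++ [ t ]) (begin
    ℓ (nf w ++ [ t ])     ≡⟨ ℓ-cong (++-congʳ [ t ] (nf≈ w)) ⟩
    ℓ (w ++ [ t ])        ≡⟨ up ⟩
    suc (length (nf w))   ≡⟨ +-comm 1 (length (nf w)) ⟩
    length (nf w) + 1     ≡⟨ length-++ (nf w) ⟨
    length (nf w ++ [ t ]) ∎)
    where open ≡-Reasoning

  descent-gained : ∀ s w t → descent s w ≡ false → descent s (w ++ [ t ]) ≡ true → (w ++ [ t ]) ≈ (s ∷ w)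
  descent-gained s w t before after with ℓ-∷ʳ± w t
  ... | inj₁ up with cancels-++ s (nf w) [ t ] cancels-W′
    where
    cancels-W′ : cancels s (nf w ++ [ t ]) ≡ true
    cancels-W′ = trans (sym (reduced⇒descent≡cancels s _ (nf-∷ʳ-reduced w t up)))
                       (trans (descent-cong s (++-congʳ [ t ] (nf≈ w))) after)
  ...   | inj₁ cancels-W = ⊥-elim (true≢false (trans (sym cancels-W)
                             (trans (sym (reduced⇒descent≡cancels s (nf w) (nf-reduced w)))
                                    (trans (descent-cong s (nf≈ w)) before))))
  ...   | inj₂ (commutes , cancels-t) with cancels-singleton s t cancels-t
  ...     | refl = begin
    w ++ [ s ]       ≈⟨ ++-congʳ [ s ] (nf≈ w) ⟨
    nf w ++ [ s ]    ≈⟨ move-to-front (nf w) [] commutes ⟩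
    s ∷ nf w ++ []   ≡⟨ cong (s ∷_) (++-identityʳ (nf w)) ⟩
    s ∷ nf w         ≈⟨ ∷-cong s (nf≈ w) ⟩
    s ∷ w            ∎
    where open ≈-Reasoning
  descent-gained s w t before after | inj₂ down = ⊥-elim (true≢false (trans (sym descent-w) before))
    where
    V = w ++ [ t ]
    V′≈w : (nf V ++ [ t ]) ≈ w
    V′≈w = ≈-trans (++-congʳ [ t ] (nf≈ V)) (cancel-∷ʳ-∷ʳ w t)
    V′-reduced : Reduced (nf V ++ [ t ])
    V′-reduced = nf-∷ʳ-reduced V t (trans (ℓ-cong (cancel-∷ʳ-∷ʳ w t)) (sym down))
    cancels-V : cancels s (nf V) ≡ true
    cancels-V = trans (sym (reduced⇒descent≡cancels s (nf V) (nf-reduced V))) (trans (descent-cong s (nf≈ V)) after)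
    descent-w : descent s w ≡ true
    descent-w = trans (sym (descent-cong s V′≈w))
                  (trans (reduced⇒descent≡cancels s _ V′-reduced) (cancels-++ʳ s (nf V) [ t ] cancels-V))

  descent-changes : ∀ s w t → ¬ descent s w ≡ descent s (w ++ [ t ]) → (w ++ [ t ]) ≈ (s ∷ w)
  descent-changes s w t changes with descent s w in e₁ | descent s (w ++ [ t ]) in e₂
  ... | false | false = ⊥-elim (changes refl)
  ... | true  | true  = ⊥-elim (changes refl)
  ... | false | true  = descent-gained s w t e₁ e₂
  ... | true  | false = begin
    w ++ [ t ]                 ≈⟨ cancel-pair [] s (w ++ [ t ]) ⟨
    s ∷ s ∷ w ++ [ t ]         ≈⟨ ∷-cong s back ⟨
    s ∷ (w ++ [ t ]) ++ [ t ]  ≈⟨ ∷-cong s (cancel-∷ʳ-∷ʳ w t) ⟩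
    s ∷ w                      ∎
    where
    open ≈-Reasoning
    back : ((w ++ [ t ]) ++ [ t ]) ≈ (s ∷ w ++ [ t ])
    back = descent-gained s (w ++ [ t ]) t e₂ (trans (descent-cong s (cancel-∷ʳ-∷ʳ w t)) e₁)

  -- Walls

  -- side splits W into two halfspaces; an edge joins them only if the reflection r swaps its ends.
  module Wall (side : Word → Bool) (r : Word)
              (side-cong : ∀ {z z′} → z ≈ z′ → side z ≡ side z′)
              (crossing : ∀ z t → ¬ side z ≡ side (z ++ [ t ]) → (z ++ [ t ]) ≈ (r ++ z))
              (r-involutive : ∀ z → (r ++ r ++ z) ≈ z) where

    crossing-edge : ∀ z γ → ¬ side z ≡ side (z ++ γ) →
      Σ Word λ α → Σ S λ t → Σ Word λ β →
        (γ ≡ α ++ t ∷ β) × ¬ side (z ++ α) ≡ side ((z ++ α) ++ [ t ])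
    crossing-edge z [] ne = ⊥-elim (ne (cong side (sym (++-identityʳ z))))
    crossing-edge z (t ∷ γ) ne with side z ≟ᵇ side (z ++ [ t ])
    ... | no ne′ = [] , t , γ , refl , subst (λ q → ¬ side q ≡ side (q ++ [ t ])) (sym (++-identityʳ z)) ne′
    ... | yes e with crossing-edge (z ++ [ t ]) γ (λ e′ → ne (trans e (trans e′ (cong side (++-assoc z [ t ] γ)))))
    ...   | α , t′ , β , refl , ne″ =
      t ∷ α , t′ , β , refl , subst (λ q → ¬ side q ≡ side (q ++ [ t′ ])) (++-assoc z [ t ] α) ne″

    shortcut : ∀ z γ w → (z ++ γ) ≈ w → ¬ side z ≡ side w →
               Σ Word λ δ → (suc (length δ) ≡ length γ) × ((z ++ δ) ≈ (r ++ w))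
    shortcut z γ w reaches ne with crossing-edge z γ (λ e → ne (trans e (side-cong reaches)))
    ... | α , t , β , refl , crosses = α ++ β , sym (length-++-sucʳ α t β) , (begin
      z ++ α ++ β                    ≡⟨ ++-assoc z α β ⟨
      (z ++ α) ++ β                  ≈⟨ r-involutive ((z ++ α) ++ β) ⟨
      r ++ r ++ (z ++ α) ++ β        ≡⟨ cong (r ++_) (++-assoc r (z ++ α) β) ⟨
      r ++ (r ++ z ++ α) ++ β        ≈⟨ ++-congˡ r (++-congʳ β (crossing (z ++ α) t crosses)) ⟨
      r ++ ((z ++ α) ++ [ t ]) ++ β  ≡⟨ cong (r ++_) (trans (++-assoc (z ++ α) [ t ] β) (++-assoc z α (t ∷ β))) ⟩
      r ++ z ++ α ++ t ∷ β           ≈⟨ ++-congˡ r reaches ⟩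
      r ++ w                         ∎)
      where open ≈-Reasoning

    -- A geodesic crossing the wall twice could be shortened by two letters.
    side-convex : ∀ {a b c k₁ k₂} → Dist a c k₁ → Dist c b k₂ → Dist a b (k₁ + k₂) →
                  side a ≡ side b → side c ≡ side a
    side-convex {a} {b} {c} ((γ₁ , refl , reaches-c) , _) ((γ₂ , refl , reaches-b) , _) ab same
      with side c ≟ᵇ side a
    ... | yes e = e
    ... | no ne with shortcut a γ₁ c reaches-c (λ e → ne (sym e))
                   | shortcut c γ₂ b reaches-b (λ e → ne (trans e (sym same)))
    ...   | δ₁ , l₁ , ac | δ₂ , l₂ , cb =
      ⊥-elim (<⇒≱ shorter (proj₂ ab (length (δ₁ ++ δ₂)) (δ₁ ++ δ₂ , refl , path)))
      where
      path : (a ++ δ₁ ++ δ₂) ≈ b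
      path = begin
        a ++ δ₁ ++ δ₂      ≡⟨ ++-assoc a δ₁ δ₂ ⟨
        (a ++ δ₁) ++ δ₂    ≈⟨ ++-congʳ δ₂ ac ⟩
        (r ++ c) ++ δ₂     ≡⟨ ++-assoc r c δ₂ ⟩
        r ++ c ++ δ₂       ≈⟨ ++-congˡ r cb ⟩
        r ++ r ++ b        ≈⟨ r-involutive b ⟩
        b                  ∎
        where open ≈-Reasoning
      shorter : length (δ₁ ++ δ₂) < length γ₁ + length γ₂
      shorter = begin-strict
        length (δ₁ ++ δ₂)               ≡⟨ length-++ δ₁ ⟩
        length δ₁ + length δ₂           <⟨ +-monoʳ-< (length δ₁) (≤-reflexive l₂) ⟩
        length δ₁ + length γ₂           <⟨ +-monoˡ-< (length γ₂) (≤-reflexive l₁) ⟩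
        length γ₁ + length γ₂           ∎
        where open ≤-Reasoning

  -- side g s is the wall of the reflection g s g⁻¹: it separates g from g s.
  side : Word → S → Word → Bool
  side g s z = descent s (g ⁻¹ ++ z)

  reflection : Word → S → Word
  reflection g s = g ++ s ∷ g ⁻¹

  side-cong : ∀ g s {z z′} → z ≈ z′ → side g s z ≡ side g s z′
  side-cong g s e = descent-cong s (++-congˡ (g ⁻¹) e)

  side-crossing : ∀ g s z t → ¬ side g s z ≡ side g s (z ++ [ t ]) → (z ++ [ t ]) ≈ (reflection g s ++ z)
  side-crossing g s z t changes = begin
    z ++ [ t ]                 ≈⟨ cancel-inverseʳ g (z ++ [ t ]) ⟨
    g ++ g ⁻¹ ++ z ++ [ t ]    ≡⟨ cong (g ++_) (++-assoc (g ⁻¹) z [ t ]) ⟨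
    g ++ (g ⁻¹ ++ z) ++ [ t ]  ≈⟨ ++-congˡ g (descent-changes s (g ⁻¹ ++ z) t changes′) ⟩
    g ++ s ∷ g ⁻¹ ++ z         ≡⟨ ++-assoc g (s ∷ g ⁻¹) z ⟨
    reflection g s ++ z        ∎
    where
    open ≈-Reasoning
    changes′ : ¬ descent s (g ⁻¹ ++ z) ≡ descent s ((g ⁻¹ ++ z) ++ [ t ])
    changes′ e = changes (trans e (cong (descent s) (++-assoc (g ⁻¹) z [ t ])))

  reflection-involutive : ∀ g s z → (reflection g s ++ reflection g s ++ z) ≈ z
  reflection-involutive g s z = begin
    reflection g s ++ reflection g s ++ z  ≡⟨ ++-assoc g (s ∷ g ⁻¹) _ ⟩
    g ++ s ∷ g ⁻¹ ++ (g ++ s ∷ g ⁻¹) ++ z  ≡⟨ cong (λ q → g ++ s ∷ g ⁻¹ ++ q) (++-assoc g (s ∷ g ⁻¹) z) ⟩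
    g ++ s ∷ g ⁻¹ ++ g ++ s ∷ g ⁻¹ ++ z    ≈⟨ ++-congˡ g (∷-cong s (cancel-inverseˡ g (s ∷ g ⁻¹ ++ z))) ⟩
    g ++ s ∷ s ∷ g ⁻¹ ++ z                 ≈⟨ cancel-pair g s (g ⁻¹ ++ z) ⟩
    g ++ g ⁻¹ ++ z                         ≈⟨ cancel-inverseʳ g z ⟩
    z                                      ∎
    where open ≈-Reasoning

  module WallOf (g : Word) (s : S) =
    Wall (side g s) (reflection g s) (side-cong g s) (side-crossing g s) (reflection-involutive g s)

  side-self : ∀ g s → side g s g ≡ false
  side-self g s = descent-cong s (inverseˡ g)

  side-next : ∀ g s → side g s (g ++ [ s ]) ≡ true
  side-next g s = trans (descent-cong s (cancel-inverseˡ g [ s ])) (descent-∷ s [])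

  side-∷ʳ : ∀ g s z → side (g ++ [ s ]) s z ≡ not (side g s z)
  side-∷ʳ g s z = trans (cong (λ q → descent s (q ++ z)) (reverse-++ g [ s ])) (descent-∷ s (g ⁻¹ ++ z))

  side-between : ∀ g s a c b → d a c + d c b ≡ d a b → side g s a ≡ side g s b → side g s c ≡ side g s a
  side-between g s a c b e =
    WallOf.side-convex g s {a} {b} {c} (Dist-d a c) (Dist-d c b) (subst (Dist a b) (sym e) (Dist-d a b))

  ≼-side : ∀ g s {x y} → x ≼ y → side g s [] ≡ side g s y → side g s x ≡ side g s []
  ≼-side g s {x} {y} (geodesic e) = side-between g s [] x y e

  side≡cancels : ∀ g s z → side g s z ≡ cancels s (nf (g ⁻¹ ++ z))
  side≡cancels g s z =
    trans (descent-cong s (≈-sym (nf≈ (g ⁻¹ ++ z)))) (reduced⇒descent≡cancels s _ (nf-reduced (g ⁻¹ ++ z)))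

  side⇒closer : ∀ a s w → side a s w ≡ true → d (a ++ [ s ]) w < d a w
  side⇒closer a s w e =
    subst (_< d a w) (cong (λ q → ℓ (q ++ w)) (sym (reverse-++ a [ s ]))) (descent⇒ℓ< s (a ⁻¹ ++ w) e)

  ≼-side-[] : ∀ g s → g ≼ (g ++ [ s ]) → side g s [] ≡ false
  ≼-side-[] g s (geodesic e) with side g s [] in eq
  ... | false = refl
  ... | true  = ⊥-elim (true≢false (trans (sym eq)
                  (trans (sym (side-between g s [] g (g ++ [ s ]) e (trans eq (sym (side-next g s)))))
                         (side-self g s))))

  ≽-side-[] : ∀ g s → (g ++ [ s ]) ≼ g → side g s [] ≡ true
  ≽-side-[] g s (geodesic e) with side g s [] in eq
  ... | true  = refl
  ... | false = ⊥-elim (true≢false (trans (sym (side-next g s))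
                  (trans (side-between g s [] (g ++ [ s ]) g e (trans eq (sym (side-self g s)))) eq)))

  ≼-side-beyond : ∀ g s {x} → g ≼ (g ++ [ s ]) → (g ++ [ s ]) ≼ x → side g s x ≡ true
  ≼-side-beyond g s {x} g≼gs gs≼x with side g s x in eq
  ... | true  = refl
  ... | false = ⊥-elim (true≢false (trans (sym (side-next g s))
                  (trans (side-between g s g (g ++ [ s ]) x (≼-chain g≼gs gs≼x) (trans (side-self g s) (sym eq)))
                         (side-self g s))))

  -- Meets

  Meet : Word → Word → Word → Set
  Meet x u a = a ≼ x × a ≼ u × (∀ w → w ≼ x → w ≼ u → w ≼ a)

  Meet-resp : ∀ {x x′ u a} → x ≈ x′ → Meet x u a → Meet x′ u a
  Meet-resp e (a≼x , a≼u , greatest) =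
    ≼-resp ≈-refl e a≼x , a≼u , λ w w≼x′ → greatest w (≼-resp ≈-refl (≈-sym e) w≼x′)

  ≼⇒Meet : ∀ {x u} → x ≼ u → Meet x u x
  ≼⇒Meet {x} x≼u = ≼-refl x , x≼u , λ w w≼x _ → w≼x

  Meet⇒IsMeet : ∀ {x u a} → Meet x u a → IsMeet x u a
  Meet⇒IsMeet (a≼x , a≼u , greatest) =
    ≼⇒≤R a≼x , ≼⇒≤R a≼u , λ w w≤x w≤u → ≼⇒≤R (greatest w (≤R⇒≼ w≤x) (≤R⇒≼ w≤u))

  IsMeet⇒Meet : ∀ {x u a} → IsMeet x u a → Meet x u a
  IsMeet⇒Meet (a≤x , a≤u , greatest) =
    ≤R⇒≼ a≤x , ≤R⇒≼ a≤u , λ w w≼x w≼u → ≤R⇒≼ (greatest w (≼⇒≤R w≼x) (≼⇒≤R w≼u))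

  StepAway : Word → Word → S → Set
  StepAway X u s = (cancels s (X ⁻¹) ≡ true) × (side (X ++ [ s ]) s u ≡ false)

  stepAway? : ∀ X u s → Dec (StepAway X u s)
  stepAway? X u s = (cancels s (X ⁻¹) ≟ᵇ true) ×-dec (side (X ++ [ s ]) s u ≟ᵇ false)

  -- If every last letter of X points towards u, a reduced word for X⁻¹u can be appended to X.
  no-step-away⇒≼ : ∀ X u → Reduced X → (∀ s → ¬ StepAway X u s) → X ≼ u
  no-step-away⇒≼ X u rX none = geodesic (begin
    ℓ X + d X u          ≡⟨ cong (_+ d X u) (reduced⇒ℓ≡length X rX) ⟩
    length X + length Y  ≡⟨ length-++ X ⟨
    length (X ++ Y)      ≡⟨ reduced⇒ℓ≡length (X ++ Y) XY-reduced ⟨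
    ℓ (X ++ Y)           ≡⟨ ℓ-cong XY≈u ⟩
    ℓ u                  ∎)
    where
    open ≡-Reasoning
    Y = nf (X ⁻¹ ++ u)
    XY≈u : (X ++ Y) ≈ u
    XY≈u = ≈-trans (++-congˡ X (nf≈ (X ⁻¹ ++ u))) (cancel-inverseʳ X u)
    XY-reduced : Reduced (X ++ Y)
    XY-reduced = reduced-++ X Y rX (nf-reduced (X ⁻¹ ++ u)) λ s cX cY →
      none s (cX , trans (side-∷ʳ X s u) (cong not (trans (side≡cancels X s u) cY)))

  -- The wall between X and X s has id and u, hence every lower bound of X and u, on the side of X s.
  meet-step : ∀ X u s → Reduced X → StepAway X u s → ∀ a → Meet (X ++ [ s ]) u a → Meet X u a
  meet-step X u s r (c , away) a (a≼Xs , a≼u , greatest) =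
    ≼-trans a≼Xs Xs≼X , a≼u , λ w w≼X w≼u → greatest w (below w w≼X w≼u) w≼u
    where
    Xs = X ++ [ s ]
    down : suc (ℓ Xs) ≡ ℓ X
    down = last-letter-shortens X s r c
    Xs≼X : Xs ≼ X
    Xs≼X = ≼-resp ≈-refl (cancel-∷ʳ-∷ʳ X s) (≼-∷ʳ Xs s (trans (ℓ-cong (cancel-∷ʳ-∷ʳ X s)) (sym down)))
    id-beyond : side X s [] ≡ true
    id-beyond = ≽-side-[] X s Xs≼X
    u-beyond : side X s u ≡ true
    u-beyond = not-injective (trans (sym (side-∷ʳ X s u)) away)
    below : ∀ w → w ≼ X → w ≼ u → w ≼ Xs
    below w w≼X w≼u = ≼-step-down w≼X (≤-reflexive (sym down)) (subst₂ _<_ (d-sym Xs w) (d-sym X w) closer)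
      where
      closer : d Xs w < d X w
      closer = side⇒closer X s w (trans (≼-side X s w≼u (trans id-beyond (sym u-beyond))) id-beyond)

  meet-exists : ∀ n x u → ℓ x < n → Σ Word λ a → Meet x u a
  meet-exists (suc n) x u (s≤s ℓx≤n) with any? (stepAway? (nf x) u) (nf x ⁻¹)
  ... | no none = nf x , Meet-resp (nf≈ x) (≼⇒Meet X≼u)
    where
    X≼u : nf x ≼ u
    X≼u = no-step-away⇒≼ (nf x) u (nf-reduced x) λ s away → none (lose (cancels⇒∈ s _ (proj₁ away)) away)
  ... | yes found with satisfied found
  ...   | s , away@(c , _) with meet-exists n (nf x ++ [ s ]) u (≤-trans (≤-reflexive shorter) ℓx≤n)
    where shorter = trans (last-letter-shortens (nf x) s (nf-reduced x) c) (ℓ-cong (nf≈ x))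
  ...     | a , meet = a , Meet-resp (nf≈ x) (meet-step (nf x) u s (nf-reduced x) away a meet)

  meet : ∀ x u → Σ Word λ a → Meet x u a
  meet x u = meet-exists (suc (ℓ x)) x u ≤-refl

  meet-in-interval : ∀ w x → Σ Word λ a → IsMeet x w a × InInterval w a
  meet-in-interval w x with meet x w
  ... | a , x∧w = a , Meet⇒IsMeet x∧w , ≼⇒≤R (geodesic refl) , ≼⇒≤R (proj₁ (proj₂ x∧w))

  -- A step from a towards both x and u would give a larger lower bound.
  meet-geodesic : ∀ {x u a} → Meet x u a → d x a + d a u ≡ d x u
  meet-geodesic {x} {u} {a} (a≼x , a≼u , greatest) = begin
    d x a + d a u               ≡⟨ cong (_+ d a u) (trans (d-sym x a) (sym (length-reverse X′))) ⟩
    length (X′ ⁻¹) + length U′  ≡⟨ length-++ (X′ ⁻¹) ⟨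
    length (X′ ⁻¹ ++ U′)        ≡⟨ reduced⇒ℓ≡length (X′ ⁻¹ ++ U′) junction-free ⟨
    ℓ (X′ ⁻¹ ++ U′)             ≡⟨ ℓ-cong X′U′≈ ⟩
    d x u                       ∎
    where
    open ≡-Reasoning
    X′ = nf (a ⁻¹ ++ x)
    U′ = nf (a ⁻¹ ++ u)
    X′U′≈ : (X′ ⁻¹ ++ U′) ≈ (x ⁻¹ ++ u)
    X′U′≈ = ≈-trans (++-cong (⁻¹-cong (nf≈ (a ⁻¹ ++ x))) (nf≈ (a ⁻¹ ++ u))) (cancel-quotients a x u)
    no-common-step : ∀ s → cancels s (X′ ⁻¹ ⁻¹) ≡ true → cancels s U′ ≡ true → ⊥
    no-common-step s cx cu =
      <⇒≱ (≼-closer⇒ℓ< a≼x as≼x (side⇒closer a s x x-side)) (≼⇒ℓ≤ (greatest as as≼x as≼u))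
      where
      as = a ++ [ s ]
      x-side : side a s x ≡ true
      x-side = trans (side≡cancels a s x) (subst (λ w → cancels s w ≡ true) (reverse-involutive X′) cx)
      as≼x : as ≼ x
      as≼x = ≼-step-up a≼x (ℓ-∷ʳ≤ a s) (side⇒closer a s x x-side)
      as≼u : as ≼ u
      as≼u = ≼-step-up a≼u (ℓ-∷ʳ≤ a s) (side⇒closer a s u (trans (side≡cancels a s u) cu))
    junction-free : Reduced (X′ ⁻¹ ++ U′)
    junction-free =
      reduced-++ (X′ ⁻¹) U′ (reverse-reduced X′ (nf-reduced (a ⁻¹ ++ x))) (nf-reduced (a ⁻¹ ++ u)) no-common-step

  InHalfspaces : Word → Word → Word → Set
  InHalfspaces u v z = ∀ g s → side g s [] ≡ side g s u → side g s [] ≡ side g s v → side g s z ≡ side g s []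

  conv⊆halfspaces : ∀ {u v x} → InConv (Three u v) x → InHalfspaces u v x
  conv⊆halfspaces {u} {v} x∈conv = x∈conv (InHalfspaces u v) respects convex contains
    where
    respects : RespectsW (InHalfspaces u v)
    respects z z′ e z∈ g s hu hv = trans (sym (side-cong g s e)) (z∈ g s hu hv)
    convex : Convex (InHalfspaces u v)
    convex a b c k₁ k₂ a∈ b∈ ac cb ab g s hu hv =
      trans (WallOf.side-convex g s ac cb ab (trans (a∈ g s hu hv) (sym (b∈ g s hu hv)))) (a∈ g s hu hv)
    contains : ∀ z → Three u v z → InHalfspaces u v z
    contains z (inj₁ e)         g s _  _  = side-cong g s e
    contains z (inj₂ (inj₁ e))  g s hu _  = trans (side-cong g s e) (sym hu)
    contains z (inj₂ (inj₂ e))  g s _  hv = trans (side-cong g s e) (sym hv)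

  -- Let p = x ∧ y and p t a step from p towards x. The wall between p and p t has id and y on
  -- p's side, hence also x ∧ u and x ∧ v, hence u and v; so x would have to be there as well.
  below-meets⇒≼ : ∀ {u v x y a b} → InHalfspaces u v x → Meet x u a → Meet x v b → a ≼ y → b ≼ y → x ≼ y
  below-meets⇒≼ {u} {v} {x} {y} x∈hull x∧u x∧v a≼y b≼y with meet x y
  ... | p , p≼x , p≼y , greatest with d p x ≟ 0
  ...   | yes e = ≼-resp (d≡0⇒≈ e) ≈-refl p≼y
  ...   | no ne with ≼-first-step p≼x ne
  ...     | t , p≼pt , pt≼x = ⊥-elim (true≢false (trans (sym x-beyond)
              (trans (x∈hull p t (trans id-near (sym (near x∧u a≼y))) (trans id-near (sym (near x∧v b≼y)))) id-near)))
    where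
    id-near : side p t [] ≡ false
    id-near = ≼-side-[] p t p≼pt
    x-beyond : side p t x ≡ true
    x-beyond = ≼-side-beyond p t p≼pt pt≼x
    y-near : side p t y ≡ false
    y-near with side p t y in eq
    ... | false = refl
    ... | true  = ⊥-elim (<⇒≱ (≼-closer⇒ℓ< p≼y pt≼y closer) (≼⇒ℓ≤ (greatest (p ++ [ t ]) pt≼x pt≼y)))
      where
      closer : d (p ++ [ t ]) y < d p y
      closer = side⇒closer p t y eq
      pt≼y : (p ++ [ t ]) ≼ y
      pt≼y = ≼-step-up p≼y (ℓ-∷ʳ≤ p t) closer
    near : ∀ {w c} → Meet x w c → c ≼ y → side p t w ≡ false
    near {w} {c} x∧w c≼y with side p t w in eq
    ... | false = refl
    ... | true  = ⊥-elim (true≢false (trans (sym c-beyond) c-near))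
      where
      c-beyond : side p t c ≡ true
      c-beyond = trans (side-between p t x c w (meet-geodesic x∧w) (trans x-beyond (sym eq))) x-beyond
      c-near : side p t c ≡ false
      c-near = trans (≼-side p t c≼y (trans id-near (sym y-near))) id-near

  same-meets⇒≼ : ∀ {u v x y a a′ b b′} → InConv (Three u v) x →
    IsMeet x u a → IsMeet y u a′ → IsMeet x v b → IsMeet y v b′ → a ≈ a′ → b ≈ b′ → x ≼ y
  same-meets⇒≼ x∈conv x∧u (a′≤y , _) x∧v (b′≤y , _) a≈a′ b≈b′ =
    below-meets⇒≼ (conv⊆halfspaces x∈conv) (IsMeet⇒Meet x∧u) (IsMeet⇒Meet x∧v)
      (≼-resp (≈-sym a≈a′) ≈-refl (≤R⇒≼ a′≤y)) (≼-resp (≈-sym b≈b′) ≈-refl (≤R⇒≼ b′≤y))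

  meet-map-injective : ∀ u v x y a a′ b b′ → InConv (Three u v) x → InConv (Three u v) y →
    IsMeet x u a → IsMeet y u a′ → IsMeet x v b → IsMeet y v b′ → a ≈ a′ → b ≈ b′ → x ≈ y
  meet-map-injective u v x y a a′ b b′ x∈conv y∈conv x∧u y∧u x∧v y∧v a≈a′ b≈b′ = ≼-antisym
    (same-meets⇒≼ x∈conv x∧u y∧u x∧v y∧v a≈a′ b≈b′)
    (same-meets⇒≼ y∈conv y∧u x∧u y∧v x∧v (≈-sym a≈a′) (≈-sym b≈b′))

theorem5p2 : (S : Set) (m : S → S → MEntry) → IsCoxeterMatrix m → (u v : Coxeter.Word m) →
    let open Coxeter m in
      -- well defined: x ∧_R u ∈ [id,u]_R and x ∧_R v ∈ [id,v]_R exist for x ∈ conv(id,u,v)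
      (∀ x → InConv (Three u v) x → Σ Word λ a → IsMeet x u a × InInterval u a)
      × (∀ x → InConv (Three u v) x → Σ Word λ b → IsMeet x v b × InInterval v b)
      -- injective
      × (∀ x y a a' b b' → InConv (Three u v) x → InConv (Three u v) y →
           IsMeet x u a → IsMeet y u a' → IsMeet x v b → IsMeet y v b' →
           a ≈ a' → b ≈ b' → x ≈ y)
theorem5p2 S m cox u v =
  (λ x _ → meet-in-interval u x) , (λ x _ → meet-in-interval v x) , meet-map-injective u v
  where open RightAngled m cox
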